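{- Let $s\in\{3,4\}$ and $F(\mathbf x)=a_1x_1^s+\dots+a_sx_s^s$ with $a_1,\dots,a_s$ positive integers (non-exceptional if $s=4$). Let $L,M,m,K$ be positive integers with $m+K<M$, let $\mathcal A=(m+M\mathbb N)\cap[0,L^sM^s)$ and $\mathcal B=\{a\in\mathcal A:\mathcal S_F\cap\{a+1,\dots,a+K\}\neq\emptyset\}$. Suppose that $r_F(m+1,M)+\dots+r_F(m+K,M)\leq\frac12M^{s-1}$. Then $\#\mathcal A=L^sM^{s-1}$ and $\#\mathcal B\leq\frac12L^sM^{s-1}$.
   Context: $\mathbb N=\{0,1,2,\dots\}$. $\mathcal S_F=\{F(\mathbf x):\mathbf x\in\mathbb N^s\}$. $r_F(m,M)$ is the number of $\mathbf x\in(\mathbb Z/M\mathbb Z)^s$ with $F(\mathbf x)\equiv m\pmod M$. A biquadratic form is exceptional if it equals $a(c_1x_{\sigma(1)})^4+b(c_2x_{\sigma(2)})^4+4a(c_3x_{\sigma(3)})^4+4b(c_4x_{\sigma(4)})^4$ for some positive integers $a,b,c_1,\dots,c_4$ and a permutation $\sigma$. -}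

module Defs where

open import Data.Nat using (ℕ; zero; suc; _+_; _*_; _∸_; _^_; _≤_; _<_; _≤?_; _<?_)
open import Data.Nat.Divisibility using (_∣_; _∣?_)
open import Data.Nat.DivMod using (_%_)
open import Data.Nat.Properties using (_≟_)
open import Data.Fin using (Fin)
open import Data.Fin.Permutation using (Permutation′; _⟨$⟩ʳ_)
open import Data.Vec using (Vec; []; _∷_; lookup; zipWith)
import Data.Vec as V
open import Data.List using (List; []; _∷_; map; concatMap; upTo; filter; length)
open import Data.Product using (_×_; ∃; Σ; _,_)
open import Relation.Binary.PropositionalEquality using (_≡_)
open import Relation.Nullary.Decidable using (Dec; _×-dec_)

F : {s : ℕ} → Vec ℕ s → Vec ℕ s → ℕ
F {s} a x = V.sum (zipWith (λ ai xi → ai * xi ^ s) a x)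

-- All vectors in {0,…,M-1}^s, i.e. representatives of (ℤ/Mℤ)^s.
allVecs : (s M : ℕ) → List (Vec ℕ s)
allVecs zero    M = [] ∷ []
allVecs (suc s) M = concatMap (λ v → map (λ i → i ∷ v) (upTo M)) (allVecs s M)

rF : {s : ℕ} → Vec ℕ s → ℕ → (M : ℕ) → .{{_ : Data.Nat.NonZero M}} → ℕ
rF {s} a n M = length (filter (λ x → F a x % M ≟ n % M) (allVecs s M))

Exceptional : Vec ℕ 4 → Set
Exceptional a =
  Σ ℕ λ A → Σ ℕ λ B → Σ ℕ λ c₁ → Σ ℕ λ c₂ → Σ ℕ λ c₃ → Σ ℕ λ c₄ →
  Σ (Permutation′ 4) λ σ →
    (0 < A) × (0 < B) × (0 < c₁) × (0 < c₂) × (0 < c₃) × (0 < c₄) ×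
    (∀ (x : Vec ℕ 4) →
      F a x ≡ A * (c₁ * lookup x (σ ⟨$⟩ʳ Fin.zero)) ^ 4
            + B * (c₂ * lookup x (σ ⟨$⟩ʳ Fin.suc Fin.zero)) ^ 4
            + 4 * A * (c₃ * lookup x (σ ⟨$⟩ʳ Fin.suc (Fin.suc Fin.zero))) ^ 4
            + 4 * B * (c₄ * lookup x (σ ⟨$⟩ʳ Fin.suc (Fin.suc (Fin.suc Fin.zero)))) ^ 4)

-- 𝒜 = (m + Mℕ) ∩ [0, L^s M^s):  n = m + M k for some k ∈ ℕ  ⇔  m ≤ n ∧ M ∣ n ∸ m.
InA : (s L M m : ℕ) → ℕ → Set
InA s L M m n = (m ≤ n) × (M ∣ (n ∸ m)) × (n < L ^ s * M ^ s)

InA? : (s L M m n : ℕ) → Dec (InA s L M m n)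
InA? s L M m n = (m ≤? n) ×-dec ((M ∣? (n ∸ m)) ×-dec (n <? L ^ s * M ^ s))

-- #𝒜 (all elements of 𝒜 lie in [0, L^s M^s)).
cardA : (s L M m : ℕ) → ℕ
cardA s L M m = length (filter (InA? s L M m) (upTo (L ^ s * M ^ s)))

HitsSF : {s : ℕ} → Vec ℕ s → ℕ → ℕ → Set
HitsSF {s} a K n = ∃ λ (x : Vec ℕ s) → (suc n ≤ F a x) × (F a x ≤ n + K)

InB : {s : ℕ} → Vec ℕ s → (L M m K : ℕ) → ℕ → Set
InB {s} a L M m K n = InA s L M m n × HitsSF a K n

{-# OPTIONS --safe #-}
-- The elements of 𝒜 are the n < L^s M^s with n ≡ m (mod M), hence L^s M^(s-1) of them.
-- For n ∈ ℬ choose x ∈ ℕ^s with n < F(x) ≤ n + K. As the coefficients are positive and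
-- F(x) < L^s M^s, x lies in the box [0, LM)^s; moreover F(x) ≡ m + j (mod M) for some
-- 1 ≤ j ≤ K, and since K < M the residue condition pins n down from F(x), so distinct
-- elements of ℬ get distinct x. Since F(x) mod M only depends on x mod M, the box contains
-- exactly L^s (r_F(m+1, M) + … + r_F(m+K, M)) such x, which bounds #ℬ.
module Submission where

open import Defs
open import Data.Nat
open import Data.Nat.Properties
open import Data.Nat.DivMod
open import Data.Nat.Divisibility using (divides; ∣-refl)
open import Data.Nat.ListAction using (sum)
open import Data.Nat.ListAction.Properties using (sum-++)
open import Data.List using (List; []; _∷_; _++_; map; applyUpTo; upTo; filter; length; concatMap)
open import Data.List.Properties using (map-++; map-cong; map-∘; map-upTo)
open import Data.List.Relation.Unary.All using (All; []; _∷_)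
import Data.List.Relation.Unary.All as All
open import Data.List.Relation.Unary.Any using (here; there; _─_)
import Data.List.Relation.Unary.Any as Any
open import Data.List.Relation.Unary.Unique.Propositional using (Unique; []; _∷_)
open import Data.List.Membership.Propositional using (_∈_)
open import Data.List.Membership.Propositional.Properties using (∈-concatMap⁺; ∈-map⁺; ∈-upTo⁺)
open import Data.Vec using (Vec; []; _∷_; toList; zipWith; _[_]%=_)
import Data.Vec as Vec
import Data.Vec.Relation.Unary.All as VecAll
open import Data.Fin using (zero; suc)
open import Data.Bool using (true; false; if_then_else_)
open import Data.Product using (∃-syntax; _×_; _,_)
open import Data.Sum using (_⊎_; inj₁; inj₂)
open import Function using (_∘_)
open import Relation.Binary.PropositionalEquality
open import Relation.Nullary using (Dec; yes; no; does; ¬_; contradiction)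
import Algebra.Properties.CommutativeSemigroup as CommutativeSemigroupProperties
open CommutativeSemigroupProperties +-commutativeSemigroup using ()
  renaming (interchange to +-interchange; x∙yz≈y∙xz to +-left-comm; xy∙z≈xz∙y to +-right-comm)
open CommutativeSemigroupProperties *-commutativeSemigroup using ()
  renaming (interchange to *-interchange; x∙yz≈y∙xz to *-left-comm)

indicator : ∀ {p} {P : Set p} → Dec P → ℕ
indicator P? = if does P? then 1 else 0

indicator-cong : ∀ {p q} {P : Set p} {Q : Set q} (P? : Dec P) (Q? : Dec Q) →
                 (P → Q) → (Q → P) → indicator P? ≡ indicator Q?
indicator-cong (yes _) (yes _) _   _   = refl
indicator-cong (yes p) (no ¬q) P→Q _   = contradiction (P→Q p) ¬q
indicator-cong (no ¬p) (yes q) _   Q→P = contradiction (Q→P q) ¬p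
indicator-cong (no _)  (no _)  _   _   = refl

0<indicator : ∀ {p} {P : Set p} (P? : Dec P) → P → 0 < indicator P?
0<indicator (yes _) _ = z<s
0<indicator (no ¬p) p = contradiction p ¬p

length-filter≡sum-indicator : ∀ {a p} {A : Set a} {P : A → Set p} (P? : ∀ x → Dec (P x)) xs →
                              length (filter P? xs) ≡ sum (map (indicator ∘ P?) xs)
length-filter≡sum-indicator P? []       = refl
length-filter≡sum-indicator P? (x ∷ xs) with does (P? x)
... | true  = cong suc (length-filter≡sum-indicator P? xs)
... | false = length-filter≡sum-indicator P? xs

sum-map-*ˡ : ∀ {a} {A : Set a} c (f : A → ℕ) xs → sum (map (λ x → c * f x) xs) ≡ c * sum (map f xs)
sum-map-*ˡ c f []       = sym (*-zeroʳ c)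
sum-map-*ˡ c f (x ∷ xs) = trans (cong (c * f x +_) (sum-map-*ˡ c f xs)) (sym (*-distribˡ-+ c (f x) _))

sum-concatMap : ∀ {a b} {A : Set a} {B : Set b} (f : B → ℕ) (g : A → List B) xs →
                sum (map f (concatMap g xs)) ≡ sum (map (λ x → sum (map f (g x))) xs)
sum-concatMap f g []       = refl
sum-concatMap f g (x ∷ xs) = begin
  sum (map f (g x ++ concatMap g xs))              ≡⟨ cong sum (map-++ f (g x) _) ⟩
  sum (map f (g x) ++ map f (concatMap g xs))      ≡⟨ sum-++ (map f (g x)) _ ⟩
  sum (map f (g x)) + sum (map f (concatMap g xs)) ≡⟨ cong (sum (map f (g x)) +_) (sum-concatMap f g xs) ⟩
  sum (map f (g x)) + sum (map (λ x → sum (map f (g x))) xs) ∎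
  where open ≡-Reasoning

sum-map-─ : ∀ {a} {A : Set a} (w : A → ℕ) {y ys} (y∈ys : y ∈ ys) → sum (map w ys) ≡ w y + sum (map w (ys ─ y∈ys))
sum-map-─ w (here refl)                = refl
sum-map-─ w {y} {z ∷ _} (there y∈ys) = trans (cong (w z +_) (sum-map-─ w y∈ys)) (+-left-comm (w z) (w y) _)

∈-─⁺ : ∀ {a} {A : Set a} {y z : A} {ys} (y∈ys : y ∈ ys) → z ∈ ys → y ≢ z → z ∈ (ys ─ y∈ys)
∈-─⁺ (here refl)  (here refl)  y≢z = contradiction refl y≢z
∈-─⁺ (here refl)  (there z∈ys) _   = z∈ys
∈-─⁺ (there _)    (here refl)  _   = here refl
∈-─⁺ (there y∈ys) (there z∈ys) y≢z = there (∈-─⁺ y∈ys z∈ys y≢z)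

module _ {a b r} {A : Set a} {B : Set b} {R : A → B → Set r}
         (R-injective : ∀ {n n′ y} → R n y → R n′ y → n ≡ n′) (w : B → ℕ) where

  length≤sum-weights : ∀ {xs} ys → Unique xs → All (λ n → ∃[ y ] R n y × y ∈ ys × 0 < w y) xs →
                       length xs ≤ sum (map w ys)
  length≤sum-weights ys [] [] = z≤n
  length≤sum-weights {n ∷ xs} ys (n∉xs ∷ xs-unique) ((y , Rny , y∈ys , 0<wy) ∷ witnesses) = begin
    suc (length xs)                ≤⟨ +-mono-≤ 0<wy (length≤sum-weights (ys ─ y∈ys) xs-unique
                                        (All.zipWith reuse (n∉xs , witnesses))) ⟩
    w y + sum (map w (ys ─ y∈ys)) ≡⟨ sum-map-─ w y∈ys ⟨
    sum (map w ys)                 ∎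
    where
    open ≤-Reasoning
    reuse : ∀ {n′} → n ≢ n′ × (∃[ y′ ] R n′ y′ × y′ ∈ ys × 0 < w y′) →
            ∃[ y′ ] R n′ y′ × y′ ∈ (ys ─ y∈ys) × 0 < w y′
    reuse (n≢n′ , y′ , Rn′y′ , y′∈ys , 0<wy′) =
      y′ , Rn′y′ , ∈-─⁺ y∈ys y′∈ys (λ { refl → n≢n′ (R-injective Rny Rn′y′) }) , 0<wy′

sumUpTo : ℕ → (ℕ → ℕ) → ℕ
sumUpTo n f = sum (applyUpTo f n)

sumUpTo-cong : ∀ n {f g : ℕ → ℕ} → (∀ {i} → i < n → f i ≡ g i) → sumUpTo n f ≡ sumUpTo n g
sumUpTo-cong zero    _   = refl
sumUpTo-cong (suc n) f≡g = cong₂ _+_ (f≡g z<s) (sumUpTo-cong n (f≡g ∘ s<s))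

sumUpTo-zero : ∀ n → sumUpTo n (λ _ → 0) ≡ 0
sumUpTo-zero zero    = refl
sumUpTo-zero (suc n) = sumUpTo-zero n

sumUpTo-+ : ∀ m n f → sumUpTo (m + n) f ≡ sumUpTo m f + sumUpTo n (λ i → f (m + i))
sumUpTo-+ zero    n f = refl
sumUpTo-+ (suc m) n f = trans (cong (f 0 +_) (sumUpTo-+ m n (f ∘ suc))) (sym (+-assoc (f 0) _ _))

sumUpTo-distrib-+ : ∀ n f g → sumUpTo n (λ i → f i + g i) ≡ sumUpTo n f + sumUpTo n g
sumUpTo-distrib-+ zero    f g = refl
sumUpTo-distrib-+ (suc n) f g =
  trans (cong (f 0 + g 0 +_) (sumUpTo-distrib-+ n (f ∘ suc) (g ∘ suc))) (+-interchange (f 0) (g 0) _ _)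

sum-map-sumUpTo : ∀ {a} {A : Set a} K (g : A → ℕ → ℕ) xs →
                  sum (map (λ x → sumUpTo K (g x)) xs) ≡ sumUpTo K (λ j → sum (map (λ x → g x j) xs))
sum-map-sumUpTo K g []       = sym (sumUpTo-zero K)
sum-map-sumUpTo K g (x ∷ xs) =
  trans (cong (sumUpTo K (g x) +_) (sum-map-sumUpTo K g xs)) (sym (sumUpTo-distrib-+ K (g x) _))

term≤sumUpTo : ∀ n f {i} → i < n → f i ≤ sumUpTo n f
term≤sumUpTo (suc n) f {zero}  _         = m≤m+n (f 0) _
term≤sumUpTo (suc n) f {suc i} (s<s i<n) = ≤-trans (term≤sumUpTo n (f ∘ suc) i<n) (m≤n+m _ (f 0))

sumUpTo-indicator-≡ : ∀ {n p} → p < n → sumUpTo n (λ i → indicator (i ≟ p)) ≡ 1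
sumUpTo-indicator-≡ {suc n} {zero}  _         = cong suc (sumUpTo-zero n)
sumUpTo-indicator-≡ {suc n} {suc p} (s<s p<n) = sumUpTo-indicator-≡ p<n

Periodic : ℕ → (ℕ → ℕ) → Set
Periodic M f = ∀ i → f (M + i) ≡ f i

sumUpTo-periodic : ∀ L M {f} → Periodic M f → sumUpTo (L * M) f ≡ L * sumUpTo M f
sumUpTo-periodic zero    M     _ = refl
sumUpTo-periodic (suc L) M {f} f-periodic = begin
  sumUpTo (M + L * M) f                            ≡⟨ sumUpTo-+ M (L * M) f ⟩
  sumUpTo M f + sumUpTo (L * M) (λ i → f (M + i)) ≡⟨ cong (sumUpTo M f +_) (sumUpTo-cong (L * M) (λ _ → f-periodic _)) ⟩
  sumUpTo M f + sumUpTo (L * M) f                  ≡⟨ cong (sumUpTo M f +_) (sumUpTo-periodic L M f-periodic) ⟩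
  sumUpTo M f + L * sumUpTo M f                    ∎
  where open ≡-Reasoning

boxSum : (k N : ℕ) → (Vec ℕ k → ℕ) → ℕ
boxSum k N g = sum (map g (allVecs k N))

boxSum-suc : ∀ k N g → boxSum (suc k) N g ≡ boxSum k N (λ v → sumUpTo N (λ i → g (i ∷ v)))
boxSum-suc k N g = trans (sum-concatMap g (λ v → map (_∷ v) (upTo N)) (allVecs k N))
  (cong sum (map-cong (λ v → cong sum (trans (sym (map-∘ (upTo N))) (map-upTo _ N))) (allVecs k N)))

CoordinatewisePeriodic : ∀ {k} → ℕ → (Vec ℕ k → ℕ) → Set
CoordinatewisePeriodic M g = ∀ x j → g (x [ j ]%= (M +_)) ≡ g x

boxSum-periodic : ∀ k L M {g : Vec ℕ k → ℕ} → CoordinatewisePeriodic M g →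
                  boxSum k (L * M) g ≡ L ^ k * boxSum k M g
boxSum-periodic zero    L M {g} _ = sym (*-identityˡ (g [] + 0))
boxSum-periodic (suc k) L M {g} g-periodic = begin
  boxSum (suc k) (L * M) g
    ≡⟨ boxSum-suc k (L * M) g ⟩
  boxSum k (L * M) (λ v → sumUpTo (L * M) (λ i → g (i ∷ v)))
    ≡⟨ cong sum (map-cong (λ v → sumUpTo-periodic L M (λ i → g-periodic (i ∷ v) zero)) (allVecs k (L * M))) ⟩
  boxSum k (L * M) (λ v → L * rowSum v)
    ≡⟨ sum-map-*ˡ L rowSum (allVecs k (L * M)) ⟩
  L * boxSum k (L * M) rowSum
    ≡⟨ cong (L *_) (boxSum-periodic k L M (λ v j → sumUpTo-cong M (λ {i} _ → g-periodic (i ∷ v) (suc j)))) ⟩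
  L * (L ^ k * boxSum k M rowSum)
    ≡⟨ *-assoc L (L ^ k) _ ⟨
  L ^ suc k * boxSum k M rowSum
    ≡⟨ cong (L ^ suc k *_) (boxSum-suc k M g) ⟨
  L ^ suc k * boxSum (suc k) M g
    ∎
  where
  open ≡-Reasoning
  rowSum : Vec ℕ k → ℕ
  rowSum v = sumUpTo M (λ i → g (i ∷ v))

∈-allVecs : ∀ {k N} {x : Vec ℕ k} → VecAll.All (_< N) x → x ∈ allVecs k N
∈-allVecs {zero}  {x = []}    VecAll.[]          = here refl
∈-allVecs {suc k} {x = i ∷ v} (i<N VecAll.∷ v<N) =
  ∈-concatMap⁺ (λ w → map (_∷ w) (upTo _)) (Any.map (λ { refl → ∈-map⁺ (_∷ v) (∈-upTo⁺ i<N) }) (∈-allVecs v<N))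

%-cong-+ : ∀ {m m′ n n′ d} .{{_ : NonZero d}} → m % d ≡ m′ % d → n % d ≡ n′ % d → (m + n) % d ≡ (m′ + n′) % d
%-cong-+ {m} {m′} {n} {n′} {d} m≡m′ n≡n′ = begin
  (m + n) % d             ≡⟨ %-distribˡ-+ m n d ⟩
  (m % d + n % d) % d     ≡⟨ cong₂ (λ u v → (u + v) % d) m≡m′ n≡n′ ⟩
  (m′ % d + n′ % d) % d   ≡⟨ %-distribˡ-+ m′ n′ d ⟨
  (m′ + n′) % d           ∎
  where open ≡-Reasoning

%-cong-* : ∀ {m m′ n n′ d} .{{_ : NonZero d}} → m % d ≡ m′ % d → n % d ≡ n′ % d → (m * n) % d ≡ (m′ * n′) % d
%-cong-* {m} {m′} {n} {n′} {d} m≡m′ n≡n′ = begin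
  (m * n) % d             ≡⟨ %-distribˡ-* m n d ⟩
  (m % d * (n % d)) % d   ≡⟨ cong₂ (λ u v → (u * v) % d) m≡m′ n≡n′ ⟩
  (m′ % d * (n′ % d)) % d ≡⟨ %-distribˡ-* m′ n′ d ⟨
  (m′ * n′) % d           ∎
  where open ≡-Reasoning

%-cong-^ : ∀ {m m′ d} .{{_ : NonZero d}} e → m % d ≡ m′ % d → m ^ e % d ≡ m′ ^ e % d
%-cong-^ zero    _     = refl
%-cong-^ (suc e) m≡m′ = %-cong-* m≡m′ (%-cong-^ e m≡m′)

m%n≡o%n⇒m<o+n⇒m/n≤o/n : ∀ {m n o} .{{_ : NonZero n}} → m % n ≡ o % n → m < o + n → m / n ≤ o / n
m%n≡o%n⇒m<o+n⇒m/n≤o/n {m} {n} {o} m≡o m<o+n =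
  s≤s⁻¹ (*-cancelʳ-< n (m / n) (suc (o / n)) (+-cancelˡ-< (m % n) _ _ (begin-strict
    m % n + m / n * n       ≡⟨ m≡m%n+[m/n]*n m n ⟨
    m                       <⟨ m<o+n ⟩
    o + n                   ≡⟨ cong (_+ n) (trans (m≡m%n+[m/n]*n o n) (cong (_+ o / n * n) (sym m≡o))) ⟩
    m % n + o / n * n + n   ≡⟨ +-assoc (m % n) _ n ⟩
    m % n + (o / n * n + n) ≡⟨ cong (m % n +_) (+-comm _ n) ⟩
    m % n + suc (o / n) * n ∎)))
  where open ≤-Reasoning

m%n≡o%n⇒m<o+n⇒o<m+n⇒m≡o : ∀ {m n o} .{{_ : NonZero n}} → m % n ≡ o % n → m < o + n → o < m + n → m ≡ o
m%n≡o%n⇒m<o+n⇒o<m+n⇒m≡o {m} {n} {o} m≡o m<o+n o<m+n = begin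
  m                   ≡⟨ m≡m%n+[m/n]*n m n ⟩
  m % n + m / n * n   ≡⟨ cong₂ (λ r q → r + q * n) m≡o (≤-antisym (m%n≡o%n⇒m<o+n⇒m/n≤o/n m≡o m<o+n)
                                                                   (m%n≡o%n⇒m<o+n⇒m/n≤o/n (sym m≡o) o<m+n)) ⟩
  o % n + o / n * n   ≡⟨ m≡m%n+[m/n]*n o n ⟨
  o                   ∎
  where open ≡-Reasoning

m%n+k<n⇒m<o*n⇒m+k<o*n : ∀ {m n k o} .{{_ : NonZero n}} → m % n + k < n → m < o * n → m + k < o * n
m%n+k<n⇒m<o*n⇒m+k<o*n {m} {n} {k} {o} m%n+k<n m<o*n = begin-strict
  m + k                 ≡⟨ cong (_+ k) (m≡m%n+[m/n]*n m n) ⟩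
  m % n + m / n * n + k ≡⟨ +-right-comm (m % n) _ k ⟩
  m % n + k + m / n * n <⟨ +-monoˡ-< _ m%n+k<n ⟩
  suc (m / n) * n       ≤⟨ *-monoˡ-≤ n (m<n*o⇒m/o<n {m} {o} {n} m<o*n) ⟩
  o * n                 ∎
  where open ≤-Reasoning

^-distrib-* : ∀ m n e → (m * n) ^ e ≡ m ^ e * n ^ e
^-distrib-* m n zero    = refl
^-distrib-* m n (suc e) = trans (cong (m * n *_) (^-distrib-* m n e)) (*-interchange m n _ _)

m*n^[1+k]≡m*n^k*n : ∀ m n k → m * n ^ suc k ≡ m * n ^ k * n
m*n^[1+k]≡m*n^k*n m n k = trans (cong (m *_) (*-comm n (n ^ k))) (sym (*-assoc m (n ^ k) n))

-- F {s} a x is diagonal s a x by definition; separating the exponent from the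
-- number of variables is what allows induction on the vectors.
diagonal : ∀ {k} → ℕ → Vec ℕ k → Vec ℕ k → ℕ
diagonal e a x = Vec.sum (zipWith (λ aᵢ xᵢ → aᵢ * xᵢ ^ e) a x)

diagonal-%-periodic : ∀ {k} e (a : Vec ℕ k) M .{{_ : NonZero M}} x j →
                      diagonal e a (x [ j ]%= (M +_)) % M ≡ diagonal e a x % M
diagonal-%-periodic e (c ∷ a) M (i ∷ x) zero    =
  %-cong-+ (%-cong-* {c} refl (%-cong-^ e (%-remove-+ˡ i ∣-refl))) refl
diagonal-%-periodic e (c ∷ a) M (i ∷ x) (suc j) =
  %-cong-+ {c * i ^ e} refl (diagonal-%-periodic e a M x j)

diagonal<N^e⇒All<N : ∀ {k} e N (a x : Vec ℕ k) → All (0 <_) (toList a) →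
                     diagonal e a x < N ^ e → VecAll.All (_< N) x
diagonal<N^e⇒All<N e N []      []      _             _  = VecAll.[]
diagonal<N^e⇒All<N e N (c ∷ a) (i ∷ x) (0<c ∷ 0<a) F<N^e =
  i<N VecAll.∷ diagonal<N^e⇒All<N e N a x 0<a (≤-<-trans (m≤n+m _ (c * i ^ e)) F<N^e)
  where
  i<N : i < N
  i<N = ≰⇒> λ N≤i → <⇒≱ F<N^e (begin
    N ^ e                         ≤⟨ ^-monoˡ-≤ e N≤i ⟩
    i ^ e                         ≤⟨ m≤n*m (i ^ e) c {{>-nonZero 0<c}} ⟩
    c * i ^ e                     ≤⟨ m≤m+n _ _ ⟩
    c * i ^ e + diagonal e a x    ∎)
    where open ≤-Reasoning

module _ (s L M m : ℕ) .{{_ : NonZero M}} where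

  InA⇒%≡ : m < M → ∀ {n} → InA s L M m n → n % M ≡ m
  InA⇒%≡ m<M {n} (m≤n , M∣n∸m , _) = begin
    n % M             ≡⟨ cong (_% M) (m+[n∸m]≡n m≤n) ⟨
    (m + (n ∸ m)) % M ≡⟨ %-remove-+ʳ m M∣n∸m ⟩
    m % M             ≡⟨ m<n⇒m%n≡m m<M ⟩
    m                 ∎
    where open ≡-Reasoning

  %≡⇒InA : ∀ {n} → n % M ≡ m → n < L ^ s * M ^ s → InA s L M m n
  %≡⇒InA {n} n%M≡m n<N = subst (_≤ n) n%M≡m (m%n≤m n M) , divides (n / M) n∸m≡q*M , n<N
    where
    n∸m≡q*M : n ∸ m ≡ n / M * M
    n∸m≡q*M = trans (cong (_∸ m) (trans (m≡m%n+[m/n]*n n M) (cong (_+ n / M * M) n%M≡m))) (m+n∸m≡n m _)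

cardA-suc : ∀ t L M m .{{_ : NonZero M}} → m < M → cardA (suc t) L M m ≡ L ^ suc t * M ^ t
cardA-suc t L M m m<M = begin
  cardA s L M m
    ≡⟨ length-filter≡sum-indicator (InA? s L M m) (upTo N) ⟩
  sum (map (indicator ∘ InA? s L M m) (upTo N))
    ≡⟨ cong sum (map-upTo _ N) ⟩
  sumUpTo N (indicator ∘ InA? s L M m)
    ≡⟨ sumUpTo-cong N (λ {i} i<N → indicator-cong (InA? s L M m i) (i % M ≟ m)
                                     (InA⇒%≡ s L M m m<M) (λ i%M≡m → %≡⇒InA s L M m i%M≡m i<N)) ⟩
  sumUpTo N inClass
    ≡⟨ cong (λ n → sumUpTo n inClass) (m*n^[1+k]≡m*n^k*n (L ^ s) M t) ⟩
  sumUpTo (T * M) inClass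
    ≡⟨ sumUpTo-periodic T M (λ i → cong (λ r → indicator (r ≟ m)) (%-remove-+ˡ i ∣-refl)) ⟩
  T * sumUpTo M inClass
    ≡⟨ cong (T *_) (sumUpTo-cong M (λ i<M → cong (λ r → indicator (r ≟ m)) (m<n⇒m%n≡m i<M))) ⟩
  T * sumUpTo M (λ i → indicator (i ≟ m))
    ≡⟨ cong (T *_) (sumUpTo-indicator-≡ m<M) ⟩
  T * 1
    ≡⟨ *-identityʳ T ⟩
  T ∎
  where
  open ≡-Reasoning
  s N T : ℕ
  s = suc t
  N = L ^ s * M ^ s
  T = L ^ s * M ^ t
  inClass : ℕ → ℕ
  inClass i = indicator (i % M ≟ m)

module _ {t} (a : Vec ℕ (suc t)) (a-positive : All (0 <_) (toList a))
         (L M m K : ℕ) .{{_ : NonZero M}} (m+K<M : m + K < M) where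

  private
    s : ℕ
    s = suc t

    m<M : m < M
    m<M = ≤-<-trans (m≤m+n m K) m+K<M

  classHits : Vec ℕ s → ℕ
  classHits x = sumUpTo K (λ j → indicator (F a x % M ≟ (m + suc j) % M))

  boxSum-classHits : boxSum s (L * M) classHits ≡ L ^ s * sum (map (λ j → rF a (m + suc j) M) (upTo K))
  boxSum-classHits = begin
    boxSum s (L * M) classHits
      ≡⟨ boxSum-periodic s L M (λ x j → cong (λ r → sumUpTo K (λ j → indicator (r ≟ (m + suc j) % M)))
                                             (diagonal-%-periodic s a M x j)) ⟩
    L ^ s * boxSum s M classHits
      ≡⟨ cong (L ^ s *_) (sum-map-sumUpTo K (λ x j → indicator (F a x % M ≟ (m + suc j) % M)) (allVecs s M)) ⟩
    L ^ s * sumUpTo K (λ j → sum (map (λ x → indicator (F a x % M ≟ (m + suc j) % M)) (allVecs s M)))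
      ≡⟨ cong (L ^ s *_) (sumUpTo-cong K (λ _ → length-filter≡sum-indicator _ (allVecs s M))) ⟨
    L ^ s * sumUpTo K (λ j → rF a (m + suc j) M)
      ≡⟨ cong (λ r → L ^ s * sum r) (map-upTo _ K) ⟨
    L ^ s * sum (map (λ j → rF a (m + suc j) M) (upTo K)) ∎
    where open ≡-Reasoning

  Witness : ℕ → Vec ℕ s → Set
  Witness n y = n % M ≡ m × n < F a y × F a y ≤ n + K

  Witness-injective : ∀ {n n′ y} → Witness n y → Witness n′ y → n ≡ n′
  Witness-injective {y = y} (n≡m , n<F , F≤n+K) (n′≡m , n′<F , F≤n′+K) =
    m%n≡o%n⇒m<o+n⇒o<m+n⇒m≡o (trans n≡m (sym n′≡m)) (close n<F F≤n′+K) (close n′<F F≤n+K)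
    where
    close : ∀ {u v} → u < F a y → F a y ≤ v + K → u < v + M
    close u<F F≤v+K = <-≤-trans u<F (≤-trans F≤v+K (+-monoʳ-≤ _ (<⇒≤ (≤-<-trans (m≤n+m K m) m+K<M))))

  InB⇒Witness : ∀ {n} → InB a L M m K n → ∃[ y ] Witness n y × y ∈ allVecs s (L * M) × 0 < classHits y
  InB⇒Witness {n} (n∈A@(_ , _ , n<N) , y , n<F , F≤n+K) = y , (n%M≡m , n<F , F≤n+K) , y∈box , 0<classHits
    where
    open ≤-Reasoning
    n%M≡m : n % M ≡ m
    n%M≡m = InA⇒%≡ s L M m m<M n∈A
    F<[L*M]^s : F a y < (L * M) ^ s
    F<[L*M]^s = begin-strict
      F a y
        ≤⟨ F≤n+K ⟩
      n + K
        <⟨ m%n+k<n⇒m<o*n⇒m+k<o*n {o = L ^ s * M ^ t} (subst (λ r → r + K < M) (sym n%M≡m) m+K<M)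
             (subst (n <_) (m*n^[1+k]≡m*n^k*n (L ^ s) M t) n<N) ⟩
      L ^ s * M ^ t * M
        ≡⟨ m*n^[1+k]≡m*n^k*n (L ^ s) M t ⟨
      L ^ s * M ^ s
        ≡⟨ ^-distrib-* L M s ⟨
      (L * M) ^ s ∎
    y∈box : y ∈ allVecs s (L * M)
    y∈box = ∈-allVecs (diagonal<N^e⇒All<N s (L * M) a y a-positive F<[L*M]^s)
    j : ℕ
    j = F a y ∸ suc n
    F≡n+[1+j] : F a y ≡ n + suc j
    F≡n+[1+j] = trans (sym (m+[n∸m]≡n n<F)) (sym (+-suc n j))
    j<K : j < K
    j<K = +-cancelˡ-≤ n (suc j) K (subst (_≤ n + K) F≡n+[1+j] F≤n+K)
    F≡m+[1+j] : F a y % M ≡ (m + suc j) % M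
    F≡m+[1+j] = trans (cong (_% M) F≡n+[1+j])
                      (%-cong-+ (trans n%M≡m (sym (m<n⇒m%n≡m m<M))) refl)
    0<classHits : 0 < classHits y
    0<classHits = <-≤-trans (0<indicator (_ ≟ _) F≡m+[1+j])
                            (term≤sumUpTo K (λ j → indicator (F a y % M ≟ (m + suc j) % M)) j<K)

  length-B≤L^s*∑rF : ∀ {xs} → Unique xs → All (InB a L M m K) xs →
                     length xs ≤ L ^ s * sum (map (λ j → rF a (m + suc j) M) (upTo K))
  length-B≤L^s*∑rF {xs} xs-unique xs⊆B = begin
    length xs                    ≤⟨ length≤sum-weights Witness-injective classHits (allVecs s (L * M))
                                      xs-unique (All.map InB⇒Witness xs⊆B) ⟩
    boxSum s (L * M) classHits   ≡⟨ boxSum-classHits ⟩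
    L ^ s * sum (map (λ j → rF a (m + suc j) M) (upTo K)) ∎
    where open ≤-Reasoning

cardA-cardB-bounds : ∀ {t} (a : Vec ℕ (suc t)) → All (0 <_) (toList a) →
                     (L M m K : ℕ) .{{_ : NonZero M}} → m + K < M →
                     2 * sum (map (λ j → rF a (m + suc j) M) (upTo K)) ≤ M ^ t →
                     cardA (suc t) L M m ≡ L ^ suc t * M ^ t
                     × ((xs : List ℕ) → Unique xs → All (InB a L M m K) xs → 2 * length xs ≤ L ^ suc t * M ^ t)
cardA-cardB-bounds {t} a a-positive L M m K m+K<M 2∑rF≤M^t =
  cardA-suc t L M m (≤-<-trans (m≤m+n m K) m+K<M) , λ xs xs-unique xs⊆B → begin
    2 * length xs         ≤⟨ *-monoʳ-≤ 2 (length-B≤L^s*∑rF a a-positive L M m K m+K<M xs-unique xs⊆B) ⟩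
    2 * (L ^ suc t * ∑rF) ≡⟨ *-left-comm 2 (L ^ suc t) ∑rF ⟩
    L ^ suc t * (2 * ∑rF) ≤⟨ *-monoʳ-≤ (L ^ suc t) 2∑rF≤M^t ⟩
    L ^ suc t * M ^ t     ∎
  where
  open ≤-Reasoning
  ∑rF : ℕ
  ∑rF = sum (map (λ j → rF a (m + suc j) M) (upTo K))

proposition8p5 : (s : ℕ) → (s ≡ 3 ⊎ s ≡ 4) → (a : Vec ℕ s) → All (0 <_) (Data.Vec.toList a)
    → ((e : s ≡ 4) → ¬ Exceptional (subst (Vec ℕ) e a))
    → (L M m K : ℕ) → .{{_ : NonZero M}} → 0 < L → 0 < M → 0 < m → 0 < K → m + K < M
    → 2 * sum (map (λ j → rF a (m + suc j) M) (upTo K)) ≤ M ^ (s ∸ 1)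
    → (cardA s L M m ≡ L ^ s * M ^ (s ∸ 1))
      × ((xs : List ℕ) → Unique xs → All (InB a L M m K) xs → 2 * length xs ≤ L ^ s * M ^ (s ∸ 1))
proposition8p5 _ (inj₁ refl) a a-positive _ L M m K _ _ _ _ m+K<M 2∑rF≤M^t =
  cardA-cardB-bounds a a-positive L M m K m+K<M 2∑rF≤M^t
proposition8p5 _ (inj₂ refl) a a-positive _ L M m K _ _ _ _ m+K<M 2∑rF≤M^t =
  cardA-cardB-bounds a a-positive L M m K m+K<M 2∑rF≤M^t
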